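{- Suppose that the display sequent $D$ is obtained from the display sequent $D'$ by one application of a display rule or of one of the rules $(I_l)$, $(I_r)$, $(q_l)$, $(q_r)$, $(a_l)$, $(a_r)$, $(p_l)$, $(p_r)$. Then $\mathfrak L_w(D)\cong\mathfrak L_w(D')$.
   Context: Formulae: $A ::= p \mid \top \mid \bot \mid \neg A \mid (A\lor A)\mid (A\land A)\mid (A\to A)\mid \mathsf{G}A\mid \mathsf{F}A\mid \mathsf{H}A\mid \mathsf{P}A$. Structures: $X ::= A \mid I \mid {\ast}X \mid {\bullet}X \mid (X\circ X)$; a display sequent is $X\vdash Y$. The rules below are schemata in structures $X,Y,Z,W$, applied via uniform substitution; those with $\Longleftrightarrow$ may be applied in either direction. Display rules: $X\circ Y\vdash Z\Longleftrightarrow X\vdash Z\circ{\ast}Y$; $X\circ Y\vdash Z\Longleftrightarrow Y\vdash{\ast}X\circ Z$; $X\vdash Y\circ Z\Longleftrightarrow X\circ{\ast}Z\vdash Y$; $X\vdash Y\circ Z\Longleftrightarrow{\ast}Y\circ X\vdash Z$; ${\ast}X\vdash Y\Longleftrightarrow{\ast}Y\vdash X$; $X\vdash{\ast}Y\Longleftrightarrow Y\vdash{\ast}X$; ${\ast}{\ast}X\vdash Y\Longleftrightarrow X\vdash Y$; $X\vdash{\ast}{\ast}Y\Longleftrightarrow X\vdash Y$; $X\vdash{\bullet}Y\Longleftrightarrow{\bullet}X\vdash Y$. $(I_l)$: $X\vdash Y\Longleftrightarrow I\circ X\vdash Y$; $(I_r)$: $X\vdash Y\Longleftrightarrow X\vdash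 I\circ Y$; $(q_l)$: $I\vdash Y\Longleftrightarrow{\ast}I\vdash Y$; $(q_r)$: $X\vdash I\Longleftrightarrow X\vdash{\ast}I$; $(a_l)$: $X\circ(Y\circ Z)\vdash W\Longleftrightarrow(X\circ Y)\circ Z\vdash W$; $(a_r)$: $X\vdash Y\circ(Z\circ W)\Longleftrightarrow X\vdash(Y\circ Z)\circ W$; $(p_l)$: from $X\circ Y\vdash Z$ infer $Y\circ X\vdash Z$; $(p_r)$: from $X\vdash Y\circ Z$ infer $X\vdash Z\circ Y$. Labeled sequents $\mathcal R,\Gamma\Rightarrow\Delta$ ($\mathcal R$ finite set of relational atoms $Rwu$, $\Gamma,\Delta$ finite multisets of labeled formulae $w:A$); composition $(\mathcal R_1,\Gamma_1\Rightarrow\Delta_1)\otimes(\mathcal R_2,\Gamma_2\Rightarrow\Delta_2)=(\mathcal R_1\cup\mathcal R_2,\Gamma_1\uplus\Gamma_2\Rightarrow\Delta_1\uplus\Delta_2)$; isomorphism $\cong$: a bijection $f$ of label sets with $Rwu\in\mathcal R_1\iff Rf(w)f(u)\in\mathcal R_2$, $w:A\in\Gamma_1\iff f(w):A\in\Gamma_2$, $w:A\in\Delta_1\iff f(w):A\in\Delta_2$. Translation: $\mathfrak L_w(X\vdash Y)=\mathfrak L^w_1(X)\otimes\mathfrak L^w_2(Y)$ with $\mathfrak L^w_i(I)=(\emptyset\Rightarrow\emptyset)$; $\mathfrak L^w_1(A)=(w:A\Rightarrow\emptyset)$, $\mathfrak L^w_2(A)=(\emptyset\Rightarrow w:A)$;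 $\mathfrak L^w_1({\ast}X)=\mathfrak L^w_2(X)$, $\mathfrak L^w_2({\ast}X)=\mathfrak L^w_1(X)$; $\mathfrak L^w_1({\bullet}X)=(Ruw\Rightarrow\emptyset)\otimes\mathfrak L^u_1(X)$, $\mathfrak L^w_2({\bullet}X)=(Rwv\Rightarrow\emptyset)\otimes\mathfrak L^v_2(X)$ ($u,v$ fresh labels); $\mathfrak L^w_i(X\circ Y)=\mathfrak L^w_i(X)\otimes\mathfrak L^w_i(Y)$. -}

module Defs where

open import Data.Nat using (ℕ; suc)
open import Data.Product using (_×_; _,_; proj₁; proj₂)
open import Data.List using (List; []; _∷_; _++_)
open import Data.List.Membership.Propositional using (_∈_)
open import Relation.Binary.PropositionalEquality using (_≡_)
open import Function.Bundles using (_⇔_)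

data Formula : Set where
  var : ℕ → Formula
  ⊤f ⊥f : Formula
  ¬f : Formula → Formula
  _∨f_ _∧f_ _⇒f_ : Formula → Formula → Formula
  Gf Ff Hf Pf : Formula → Formula

data Struct : Set where
  fml : Formula → Struct
  I   : Struct
  ∗_  : Struct → Struct
  •_  : Struct → Struct
  _∘_ : Struct → Struct → Struct

infixr 9 ∗_ •_
infixl 8 _∘_

data DSeq : Set where
  _⊢_ : Struct → Struct → DSeq

infix 5 _⊢_

-- Rules that may be applied in either direction (X ⟹ Y read "from X infer Y")
data Bi : DSeq → DSeq → Set where
  d1 : ∀ X Y Z → Bi (X ∘ Y ⊢ Z) (X ⊢ Z ∘ ∗ Y)
  d2 : ∀ X Y Z → Bi (X ∘ Y ⊢ Z) (Y ⊢ ∗ X ∘ Z)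
  d3 : ∀ X Y Z → Bi (X ⊢ Y ∘ Z) (X ∘ ∗ Z ⊢ Y)
  d4 : ∀ X Y Z → Bi (X ⊢ Y ∘ Z) (∗ Y ∘ X ⊢ Z)
  d5 : ∀ X Y → Bi (∗ X ⊢ Y) (∗ Y ⊢ X)
  d6 : ∀ X Y → Bi (X ⊢ ∗ Y) (Y ⊢ ∗ X)
  d7 : ∀ X Y → Bi (∗ ∗ X ⊢ Y) (X ⊢ Y)
  d8 : ∀ X Y → Bi (X ⊢ ∗ ∗ Y) (X ⊢ Y)
  d9 : ∀ X Y → Bi (X ⊢ • Y) (• X ⊢ Y)
  Il : ∀ X Y → Bi (X ⊢ Y) (I ∘ X ⊢ Y)
  Ir : ∀ X Y → Bi (X ⊢ Y) (X ⊢ I ∘ Y)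
  ql : ∀ Y → Bi (I ⊢ Y) (∗ I ⊢ Y)
  qr : ∀ X → Bi (X ⊢ I) (X ⊢ ∗ I)
  al : ∀ X Y Z W → Bi (X ∘ (Y ∘ Z) ⊢ W) ((X ∘ Y) ∘ Z ⊢ W)
  ar : ∀ X Y Z W → Bi (X ⊢ Y ∘ (Z ∘ W)) (X ⊢ (Y ∘ Z) ∘ W)

-- One application of a rule: Step D' D means D is obtained from D'
data Step : DSeq → DSeq → Set where
  fwd : ∀ {D D'} → Bi D' D → Step D' D
  bwd : ∀ {D D'} → Bi D D' → Step D' D
  pl  : ∀ X Y Z → Step (X ∘ Y ⊢ Z) (Y ∘ X ⊢ Z)
  pr  : ∀ X Y Z → Step (X ⊢ Y ∘ Z) (X ⊢ Z ∘ Y)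

Label : Set
Label = ℕ

-- Labeled sequents R, Γ ⇒ Δ : relational atoms R w u as pairs (w , u);
-- Γ, Δ as lists of labeled formulae (w , A)
record LSeq : Set where
  constructor lseq
  field
    rel : List (Label × Label)
    ant : List (Label × Formula)
    suc' : List (Label × Formula)
open LSeq public

emptyS : LSeq
emptyS = lseq [] [] []

_⊗_ : LSeq → LSeq → LSeq
lseq R₁ Γ₁ Δ₁ ⊗ lseq R₂ Γ₂ Δ₂ = lseq (R₁ ++ R₂) (Γ₁ ++ Γ₂) (Δ₁ ++ Δ₂)

-- Translation. The extra ℕ argument is the next fresh label; it is
-- threaded through so every fresh label is distinct from all others.
mutual
  𝔏₁ : Label → Struct → ℕ → LSeq × ℕ
  𝔏₁ w (fml A) n = lseq [] ((w , A) ∷ []) [] , n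
  𝔏₁ w I n = emptyS , n
  𝔏₁ w (∗ X) n = 𝔏₂ w X n
  𝔏₁ w (• X) n with 𝔏₁ n X (suc n)
  ... | s , n' = lseq ((n , w) ∷ []) [] [] ⊗ s , n'
  𝔏₁ w (X ∘ Y) n with 𝔏₁ w X n
  ... | s₁ , n₁ with 𝔏₁ w Y n₁
  ... | s₂ , n₂ = s₁ ⊗ s₂ , n₂

  𝔏₂ : Label → Struct → ℕ → LSeq × ℕ
  𝔏₂ w (fml A) n = lseq [] [] ((w , A) ∷ []) , n
  𝔏₂ w I n = emptyS , n
  𝔏₂ w (∗ X) n = 𝔏₁ w X n
  𝔏₂ w (• X) n with 𝔏₂ n X (suc n)
  ... | s , n' = lseq ((w , n) ∷ []) [] [] ⊗ s , n'
  𝔏₂ w (X ∘ Y) n with 𝔏₂ w X n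
  ... | s₁ , n₁ with 𝔏₂ w Y n₁
  ... | s₂ , n₂ = s₁ ⊗ s₂ , n₂

𝔏 : Label → DSeq → LSeq
𝔏 w (X ⊢ Y) with 𝔏₁ w X (suc w)
... | s₁ , n₁ = s₁ ⊗ proj₁ (𝔏₂ w Y n₁)

data Occurs (l : Label) (S : LSeq) : Set where
  inRel₁ : ∀ u → (l , u) ∈ rel S → Occurs l S
  inRel₂ : ∀ u → (u , l) ∈ rel S → Occurs l S
  inAnt  : ∀ A → (l , A) ∈ ant S → Occurs l S
  inSuc  : ∀ A → (l , A) ∈ suc' S → Occurs l S

record _≅_ (S₁ S₂ : LSeq) : Set where
  field
    f g : Label → Label
    f-into : ∀ l → Occurs l S₁ → Occurs (f l) S₂
    g-into : ∀ l → Occurs l S₂ → Occurs (g l) S₁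
    gf : ∀ l → Occurs l S₁ → g (f l) ≡ l
    fg : ∀ l → Occurs l S₂ → f (g l) ≡ l
    rel-iso : ∀ w u → Occurs w S₁ → Occurs u S₁ →
              ((w , u) ∈ rel S₁) ⇔ ((f w , f u) ∈ rel S₂)
    ant-iso : ∀ w A → Occurs w S₁ →
              ((w , A) ∈ ant S₁) ⇔ ((f w , A) ∈ ant S₂)
    suc-iso : ∀ w A → Occurs w S₁ →
              ((w , A) ∈ suc' S₁) ⇔ ((f w , A) ∈ suc' S₂)

infix 4 _≅_

module Submission where

-- The translation of X ⊢ Y depends only on the sequence of its pieces: the formulae and
-- •-substructures left after unfolding ∘, I and ∗, each tagged with the side of ⊢ it ends up
-- on. The pieces are translated one after the other, each taking its fresh labels from the
-- next free block. Every rule other than X ⊢ •Y ⟺ •X ⊢ Y either leaves this sequence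
-- unchanged (up to bracketing) or exchanges two adjacent blocks of pieces; relabelling by the
-- exchange of the corresponding blocks of fresh labels turns one translation into the other
-- up to reordering its lists. For X ⊢ •Y ⟺ •X ⊢ Y the relabelling exchanges the block made
-- of w and the fresh labels of X with the fresh label introduced by the •.

open import Defs
open import Data.Nat using (ℕ; zero; suc; _+_; _∸_; _<_; _≤_; _<?_; z<s; s<s)
open import Data.Nat.Properties
open import Algebra.Properties.CommutativeSemigroup +-commutativeSemigroup using (xy∙z≈xz∙y)
open import Data.Product using (_×_; _,_; proj₁; proj₂; ∃)
import Data.Product as ×
open import Data.List using (List; []; _∷_; _++_; map)
open import Data.List.Properties using (++-assoc; ++-identityʳ; map-++)
open import Relation.Binary.PropositionalEquality
open import Relation.Nullary using (yes; no)
open import Relation.Nullary.Negation using (contradiction)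
open import Data.List.Membership.Propositional using (_∈_)
open import Data.List.Membership.Propositional.Properties using (∈-map⁺; ∈-map⁻)
open import Data.List.Relation.Binary.Permutation.Propositional using (_↭_; ↭-sym)
open import Data.List.Relation.Binary.Permutation.Propositional.Properties using (∈-resp-↭; ++⁺ˡ; shifts)
open import Function.Bundles using (_⇔_; mk⇔)
open import Function.Construct.Identity using (⇔-id)
open import Function.Construct.Symmetry using (⇔-sym)
open import Function.Construct.Composition using (_⇔-∘_)

data Side : Set where
  lhs rhs : Side

flip : Side → Side
flip lhs = rhs
flip rhs = lhs

translate : Side → Label → Struct → ℕ → LSeq × ℕ
translate lhs = 𝔏₁
translate rhs = 𝔏₂

bullets : Struct → ℕ
bullets (fml A) = 0
bullets I = 0
bullets (∗ X) = bullets X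
bullets (• X) = suc (bullets X)
bullets (X ∘ Y) = bullets X + bullets Y

atom : Side → Label → Formula → LSeq
atom lhs w A = lseq [] ((w , A) ∷ []) []
atom rhs w A = lseq [] [] ((w , A) ∷ [])

edge : Side → Label → Label → LSeq
edge lhs w u = lseq ((u , w) ∷ []) [] []
edge rhs w u = lseq ((w , u) ∷ []) [] []

tr : Side → Label → Struct → ℕ → LSeq
tr s w (fml A) n = atom s w A
tr s w I n = emptyS
tr s w (∗ X) n = tr (flip s) w X n
tr s w (• X) n = edge s w n ⊗ tr s n X (suc n)
tr s w (X ∘ Y) n = tr s w X n ⊗ tr s w Y (n + bullets X)

translate-closed : ∀ s w X n → translate s w X n ≡ (tr s w X n , n + bullets X)
translate-closed lhs w (fml A) n = cong (_ ,_) (sym (+-identityʳ n))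
translate-closed rhs w (fml A) n = cong (_ ,_) (sym (+-identityʳ n))
translate-closed lhs w I n = cong (_ ,_) (sym (+-identityʳ n))
translate-closed rhs w I n = cong (_ ,_) (sym (+-identityʳ n))
translate-closed lhs w (∗ X) n = translate-closed rhs w X n
translate-closed rhs w (∗ X) n = translate-closed lhs w X n
translate-closed lhs w (• X) n rewrite translate-closed lhs n X (suc n) =
  cong (tr lhs w (• X) n ,_) (sym (+-suc n (bullets X)))
translate-closed rhs w (• X) n rewrite translate-closed rhs n X (suc n) =
  cong (tr rhs w (• X) n ,_) (sym (+-suc n (bullets X)))
translate-closed lhs w (X ∘ Y) n
  rewrite translate-closed lhs w X n | translate-closed lhs w Y (n + bullets X) =
  cong (tr lhs w (X ∘ Y) n ,_) (+-assoc n (bullets X) (bullets Y))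
translate-closed rhs w (X ∘ Y) n
  rewrite translate-closed rhs w X n | translate-closed rhs w Y (n + bullets X) =
  cong (tr rhs w (X ∘ Y) n ,_) (+-assoc n (bullets X) (bullets Y))

𝔏-closed : ∀ w X Y → 𝔏 w (X ⊢ Y) ≡ tr lhs w X (suc w) ⊗ tr rhs w Y (suc w + bullets X)
𝔏-closed w X Y
  rewrite translate-closed lhs w X (suc w) | translate-closed rhs w Y (suc w + bullets X) = refl

⊗-assoc : ∀ S₁ S₂ S₃ → (S₁ ⊗ S₂) ⊗ S₃ ≡ S₁ ⊗ (S₂ ⊗ S₃)
⊗-assoc (lseq R₁ Γ₁ Δ₁) (lseq R₂ Γ₂ Δ₂) (lseq R₃ Γ₃ Δ₃)
  rewrite ++-assoc R₁ R₂ R₃ | ++-assoc Γ₁ Γ₂ Γ₃ | ++-assoc Δ₁ Δ₂ Δ₃ = refl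

⊗-identityʳ : ∀ S → S ⊗ emptyS ≡ S
⊗-identityʳ (lseq R Γ Δ) rewrite ++-identityʳ R | ++-identityʳ Γ | ++-identityʳ Δ = refl

Piece : Set
Piece = Side × Struct

width : List Piece → ℕ
width [] = 0
width ((_ , X) ∷ ps) = bullets X + width ps

layout : Label → ℕ → List Piece → LSeq
layout w n [] = emptyS
layout w n ((s , X) ∷ ps) = tr s w X n ⊗ layout w (n + bullets X) ps

layout-++ : ∀ w n ps qs → layout w n (ps ++ qs) ≡ layout w n ps ⊗ layout w (n + width ps) qs
layout-++ w n [] qs = cong (λ m → layout w m qs) (sym (+-identityʳ n))
layout-++ w n ((s , X) ∷ ps) qs = begin
  tr s w X n ⊗ layout w (n + x) (ps ++ qs)
    ≡⟨ cong (tr s w X n ⊗_) (layout-++ w (n + x) ps qs) ⟩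
  tr s w X n ⊗ (layout w (n + x) ps ⊗ layout w (n + x + width ps) qs)
    ≡⟨ cong (λ m → tr s w X n ⊗ (layout w (n + x) ps ⊗ layout w m qs))
            (+-assoc n x (width ps)) ⟩
  tr s w X n ⊗ (layout w (n + x) ps ⊗ layout w (n + (x + width ps)) qs)
    ≡⟨ sym (⊗-assoc (tr s w X n) _ _) ⟩
  (tr s w X n ⊗ layout w (n + x) ps) ⊗ layout w (n + (x + width ps)) qs ∎
  where open ≡-Reasoning
        x = bullets X

layout-++₄ : ∀ w n ps qs rs ts →
  layout w n (ps ++ qs ++ rs ++ ts) ≡
  layout w n ps ⊗ (layout w (n + width ps) qs ⊗
    (layout w (n + width ps + width qs) rs ⊗ layout w (n + width ps + width qs + width rs) ts))
layout-++₄ w n ps qs rs ts =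
  trans (layout-++ w n ps _) (cong (layout w n ps ⊗_)
    (trans (layout-++ w a qs _) (cong (layout w a qs ⊗_) (layout-++ w (a + width qs) rs ts))))
  where a = n + width ps

pieces : Side → Struct → List Piece
pieces s (fml A) = (s , fml A) ∷ []
pieces s I = []
pieces s (∗ X) = pieces (flip s) X
pieces s (• X) = (s , • X) ∷ []
pieces s (X ∘ Y) = pieces s X ++ pieces s Y

width-++ : ∀ ps qs → width (ps ++ qs) ≡ width ps + width qs
width-++ [] qs = refl
width-++ ((_ , X) ∷ ps) qs =
  trans (cong (bullets X +_) (width-++ ps qs)) (sym (+-assoc (bullets X) (width ps) (width qs)))

width-pieces : ∀ s X → width (pieces s X) ≡ bullets X
width-pieces s (fml A) = refl
width-pieces s I = refl
width-pieces s (∗ X) = width-pieces (flip s) X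
width-pieces s (• X) = +-identityʳ (suc (bullets X))
width-pieces s (X ∘ Y) =
  trans (width-++ (pieces s X) (pieces s Y)) (cong₂ _+_ (width-pieces s X) (width-pieces s Y))

tr-pieces : ∀ s w X n → tr s w X n ≡ layout w n (pieces s X)
tr-pieces s w (fml A) n = sym (⊗-identityʳ (atom s w A))
tr-pieces s w I n = refl
tr-pieces s w (∗ X) n = tr-pieces (flip s) w X n
tr-pieces s w (• X) n = sym (⊗-identityʳ (tr s w (• X) n))
tr-pieces s w (X ∘ Y) n = begin
  tr s w X n ⊗ tr s w Y (n + bullets X)
    ≡⟨ cong₂ _⊗_ (tr-pieces s w X n) (tr-pieces s w Y (n + bullets X)) ⟩
  layout w n (pieces s X) ⊗ layout w (n + bullets X) (pieces s Y)
    ≡⟨ cong (λ m → layout w n (pieces s X) ⊗ layout w (n + m) (pieces s Y))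
            (sym (width-pieces s X)) ⟩
  layout w n (pieces s X) ⊗ layout w (n + width (pieces s X)) (pieces s Y)
    ≡⟨ sym (layout-++ w n (pieces s X) (pieces s Y)) ⟩
  layout w n (pieces s X ++ pieces s Y) ∎
  where open ≡-Reasoning

seqPieces : DSeq → List Piece
seqPieces (X ⊢ Y) = pieces lhs X ++ pieces rhs Y

𝔏-layout : ∀ w D → 𝔏 w D ≡ layout w (suc w) (seqPieces D)
𝔏-layout w (X ⊢ Y) = trans (𝔏-closed w X Y) (tr-pieces lhs w (X ∘ ∗ Y) (suc w))

≅-refl : ∀ {S} → S ≅ S
≅-refl = record
  { f = λ l → l ; g = λ l → l
  ; f-into = λ _ o → o ; g-into = λ _ o → o
  ; gf = λ _ _ → refl ; fg = λ _ _ → refl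
  ; rel-iso = λ _ _ _ _ → ⇔-id _
  ; ant-iso = λ _ _ _ → ⇔-id _
  ; suc-iso = λ _ _ _ → ⇔-id _
  }

≅-sym : ∀ {S₁ S₂} → S₁ ≅ S₂ → S₂ ≅ S₁
≅-sym {S₁} {S₂} i = record
  { f = g ; g = f
  ; f-into = g-into ; g-into = f-into
  ; gf = fg ; fg = gf
  ; rel-iso = λ w u ow ou → reverse (rel S₂) (cong₂ _,_ (fg w ow) (fg u ou))
                              (rel-iso (g w) (g u) (g-into w ow) (g-into u ou))
  ; ant-iso = λ w A ow → reverse (ant S₂) (cong (_, A) (fg w ow)) (ant-iso (g w) A (g-into w ow))
  ; suc-iso = λ w A ow → reverse (suc' S₂) (cong (_, A) (fg w ow)) (suc-iso (g w) A (g-into w ow))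
  }
  where
  open _≅_ i
  reverse : ∀ {B P : Set} (xs : List B) {x y} → y ≡ x → P ⇔ (y ∈ xs) → (x ∈ xs) ⇔ P
  reverse xs refl e = ⇔-sym e

≅-trans : ∀ {S₁ S₂ S₃} → S₁ ≅ S₂ → S₂ ≅ S₃ → S₁ ≅ S₃
≅-trans i j = record
  { f = λ l → J.f (I.f l) ; g = λ l → I.g (J.g l)
  ; f-into = λ l o → J.f-into _ (I.f-into l o)
  ; g-into = λ l o → I.g-into _ (J.g-into l o)
  ; gf = λ l o → trans (cong I.g (J.gf _ (I.f-into l o))) (I.gf l o)
  ; fg = λ l o → trans (cong J.f (I.fg _ (J.g-into l o))) (J.fg l o)
  ; rel-iso = λ w u ow ou →
      J.rel-iso (I.f w) (I.f u) (I.f-into w ow) (I.f-into u ou) ⇔-∘ I.rel-iso w u ow ou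
  ; ant-iso = λ w A ow → J.ant-iso (I.f w) A (I.f-into w ow) ⇔-∘ I.ant-iso w A ow
  ; suc-iso = λ w A ow → J.suc-iso (I.f w) A (I.f-into w ow) ⇔-∘ I.suc-iso w A ow
  }
  where
  module I = _≅_ i
  module J = _≅_ j

record _~_ (S₁ S₂ : LSeq) : Set where
  field
    rel-↭ : rel S₁ ↭ rel S₂
    ant-↭ : ant S₁ ↭ ant S₂
    suc-↭ : suc' S₁ ↭ suc' S₂
open _~_

infix 4 _~_

~-sym : ∀ {S₁ S₂} → S₁ ~ S₂ → S₂ ~ S₁
~-sym e = record
  { rel-↭ = ↭-sym (rel-↭ e) ; ant-↭ = ↭-sym (ant-↭ e) ; suc-↭ = ↭-sym (suc-↭ e) }

Occurs-resp-~ : ∀ {S₁ S₂} → S₁ ~ S₂ → ∀ l → Occurs l S₁ → Occurs l S₂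
Occurs-resp-~ e l (inRel₁ u m) = inRel₁ u (∈-resp-↭ (rel-↭ e) m)
Occurs-resp-~ e l (inRel₂ u m) = inRel₂ u (∈-resp-↭ (rel-↭ e) m)
Occurs-resp-~ e l (inAnt A m) = inAnt A (∈-resp-↭ (ant-↭ e) m)
Occurs-resp-~ e l (inSuc A m) = inSuc A (∈-resp-↭ (suc-↭ e) m)

~⇒≅ : ∀ {S₁ S₂} → S₁ ~ S₂ → S₁ ≅ S₂
~⇒≅ e = record
  { f = λ l → l ; g = λ l → l
  ; f-into = Occurs-resp-~ e ; g-into = Occurs-resp-~ (~-sym e)
  ; gf = λ _ _ → refl ; fg = λ _ _ → refl
  ; rel-iso = λ _ _ _ _ → mk⇔ (∈-resp-↭ (rel-↭ e)) (∈-resp-↭ (↭-sym (rel-↭ e)))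
  ; ant-iso = λ _ _ _ → mk⇔ (∈-resp-↭ (ant-↭ e)) (∈-resp-↭ (↭-sym (ant-↭ e)))
  ; suc-iso = λ _ _ _ → mk⇔ (∈-resp-↭ (suc-↭ e)) (∈-resp-↭ (↭-sym (suc-↭ e)))
  }

⊗-shifts : ∀ S₁ S₂ S₃ S₄ → S₁ ⊗ (S₂ ⊗ (S₃ ⊗ S₄)) ~ S₁ ⊗ (S₃ ⊗ (S₂ ⊗ S₄))
⊗-shifts (lseq R₁ Γ₁ Δ₁) (lseq R₂ Γ₂ Δ₂) (lseq R₃ Γ₃ Δ₃) (lseq R₄ Γ₄ Δ₄) = record
  { rel-↭ = ++⁺ˡ R₁ (shifts R₂ R₃)
  ; ant-↭ = ++⁺ˡ Γ₁ (shifts Γ₂ Γ₃)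
  ; suc-↭ = ++⁺ˡ Δ₁ (shifts Δ₂ Δ₃)
  }

renRel : (Label → Label) → Label × Label → Label × Label
renRel ρ = ×.map ρ ρ

renFml : (Label → Label) → Label × Formula → Label × Formula
renFml ρ = ×.map₁ ρ

ren : (Label → Label) → LSeq → LSeq
ren ρ (lseq R Γ Δ) = lseq (map (renRel ρ) R) (map (renFml ρ) Γ) (map (renFml ρ) Δ)

ren-⊗ : ∀ ρ S₁ S₂ → ren ρ (S₁ ⊗ S₂) ≡ ren ρ S₁ ⊗ ren ρ S₂
ren-⊗ ρ (lseq R₁ Γ₁ Δ₁) (lseq R₂ Γ₂ Δ₂)
  rewrite map-++ (renRel ρ) R₁ R₂ | map-++ (renFml ρ) Γ₁ Γ₂ | map-++ (renFml ρ) Δ₁ Δ₂ =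
  refl

ren-⊗₄ : ∀ ρ S₁ S₂ S₃ S₄ →
         ren ρ (S₁ ⊗ (S₂ ⊗ (S₃ ⊗ S₄))) ≡ ren ρ S₁ ⊗ (ren ρ S₂ ⊗ (ren ρ S₃ ⊗ ren ρ S₄))
ren-⊗₄ ρ S₁ S₂ S₃ S₄ =
  trans (ren-⊗ ρ S₁ _)
        (cong (ren ρ S₁ ⊗_) (trans (ren-⊗ ρ S₂ _) (cong (ren ρ S₂ ⊗_) (ren-⊗ ρ S₃ S₄))))

module _ (ρ σ : Label → Label) (σ∘ρ : ∀ l → σ (ρ l) ≡ l) where

  private
    ρ-injective : ∀ {a b} → ρ a ≡ ρ b → a ≡ b
    ρ-injective {a} {b} e = trans (sym (σ∘ρ a)) (trans (cong σ e) (σ∘ρ b))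

    Occurs-ren : ∀ S l → Occurs l S → Occurs (ρ l) (ren ρ S)
    Occurs-ren S l (inRel₁ u m) = inRel₁ (ρ u) (∈-map⁺ (renRel ρ) m)
    Occurs-ren S l (inRel₂ u m) = inRel₂ (ρ u) (∈-map⁺ (renRel ρ) m)
    Occurs-ren S l (inAnt A m) = inAnt A (∈-map⁺ (renFml ρ) m)
    Occurs-ren S l (inSuc A m) = inSuc A (∈-map⁺ (renFml ρ) m)

    Occurs-ren⁻ : ∀ S l → Occurs l (ren ρ S) → ∃ λ l' → Occurs l' S × l ≡ ρ l'
    Occurs-ren⁻ S l (inRel₁ u m) with ∈-map⁻ (renRel ρ) m
    ... | (a , b) , m' , refl = a , inRel₁ b m' , refl
    Occurs-ren⁻ S l (inRel₂ u m) with ∈-map⁻ (renRel ρ) m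
    ... | (a , b) , m' , refl = b , inRel₂ a m' , refl
    Occurs-ren⁻ S l (inAnt A m) with ∈-map⁻ (renFml ρ) m
    ... | (a , B) , m' , refl = a , inAnt B m' , refl
    Occurs-ren⁻ S l (inSuc A m) with ∈-map⁻ (renFml ρ) m
    ... | (a , B) , m' , refl = a , inSuc B m' , refl

    ∈-map-rel⁻ : ∀ R w u → (ρ w , ρ u) ∈ map (renRel ρ) R → (w , u) ∈ R
    ∈-map-rel⁻ R w u m with ∈-map⁻ (renRel ρ) m
    ... | _ , m' , e with ρ-injective (cong proj₁ e) | ρ-injective (cong proj₂ e)
    ... | refl | refl = m'

    ∈-map-fml⁻ : ∀ Γ w A → (ρ w , A) ∈ map (renFml ρ) Γ → (w , A) ∈ Γ
    ∈-map-fml⁻ Γ w A m with ∈-map⁻ (renFml ρ) m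
    ... | _ , m' , e with ρ-injective (cong proj₁ e) | cong proj₂ e
    ... | refl | refl = m'

    σ-into : ∀ S l → Occurs l (ren ρ S) → Occurs (σ l) S
    σ-into S l o with Occurs-ren⁻ S l o
    ... | l' , o' , refl rewrite σ∘ρ l' = o'

    ρ∘σ : ∀ S l → Occurs l (ren ρ S) → ρ (σ l) ≡ l
    ρ∘σ S l o with Occurs-ren⁻ S l o
    ... | l' , _ , refl = cong ρ (σ∘ρ l')

  ren-≅ : ∀ S → S ≅ ren ρ S
  ren-≅ S = record
    { f = ρ ; g = σ
    ; f-into = Occurs-ren S
    ; g-into = σ-into S
    ; gf = λ l _ → σ∘ρ l
    ; fg = ρ∘σ S
    ; rel-iso = λ w u _ _ → mk⇔ (∈-map⁺ (renRel ρ)) (∈-map-rel⁻ (rel S) w u)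
    ; ant-iso = λ w A _ → mk⇔ (∈-map⁺ (renFml ρ)) (∈-map-fml⁻ (ant S) w A)
    ; suc-iso = λ w A _ → mk⇔ (∈-map⁺ (renFml ρ)) (∈-map-fml⁻ (suc' S) w A)
    }

record Shifts (ρ : Label → Label) (n m k : ℕ) : Set where
  constructor shifts-by
  field shift : ∀ j → j < k → ρ (n + j) ≡ m + j
open Shifts

module _ {ρ : Label → Label} {n m : ℕ} where

  Shifts-head : ∀ {k} → Shifts ρ n m (suc k) → ρ n ≡ m
  Shifts-head sh = trans (cong ρ (sym (+-identityʳ n))) (trans (shift sh 0 z<s) (+-identityʳ m))

  Shifts-tail : ∀ {k} → Shifts ρ n m (suc k) → Shifts ρ (suc n) (suc m) k
  Shifts-tail sh = shifts-by λ j j<k →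
    trans (cong ρ (sym (+-suc n j))) (trans (shift sh (suc j) (s<s j<k)) (+-suc m j))

  Shifts-take : ∀ k {l} → Shifts ρ n m (k + l) → Shifts ρ n m k
  Shifts-take k {l} sh = shifts-by λ j j<k → shift sh j (<-≤-trans j<k (m≤m+n k l))

  Shifts-drop : ∀ k {l} → Shifts ρ n m (k + l) → Shifts ρ (n + k) (m + k) l
  Shifts-drop k sh = shifts-by λ j j<l →
    trans (cong ρ (+-assoc n k j)) (trans (shift sh (k + j) (+-monoʳ-< k j<l)) (sym (+-assoc m k j)))

ren-atom : ∀ ρ s w A → ren ρ (atom s w A) ≡ atom s (ρ w) A
ren-atom ρ lhs w A = refl
ren-atom ρ rhs w A = refl

ren-edge : ∀ ρ s w u → ren ρ (edge s w u) ≡ edge s (ρ w) (ρ u)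
ren-edge ρ lhs w u = refl
ren-edge ρ rhs w u = refl

ren-tr : ∀ ρ s X {w w' n m} → ρ w ≡ w' → Shifts ρ n m (bullets X) →
         ren ρ (tr s w X n) ≡ tr s w' X m
ren-tr ρ s (fml A) {w} refl sh = ren-atom ρ s w A
ren-tr ρ s I e sh = refl
ren-tr ρ s (∗ X) e sh = ren-tr ρ (flip s) X e sh
ren-tr ρ s (• X) {w} {n = n} refl sh =
  trans (ren-⊗ ρ (edge s w n) _)
        (cong₂ _⊗_ (trans (ren-edge ρ s w n) (cong (edge s (ρ w)) (Shifts-head sh)))
                   (ren-tr ρ s X (Shifts-head sh) (Shifts-tail sh)))
ren-tr ρ s (X ∘ Y) {w} {n = n} e sh =
  trans (ren-⊗ ρ (tr s w X n) _)
        (cong₂ _⊗_ (ren-tr ρ s X e (Shifts-take (bullets X) sh))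
                   (ren-tr ρ s Y e (Shifts-drop (bullets X) sh)))

ren-layout : ∀ ρ ps {w w' n m} → ρ w ≡ w' → Shifts ρ n m (width ps) →
             ren ρ (layout w n ps) ≡ layout w' m ps
ren-layout ρ [] e sh = refl
ren-layout ρ ((s , X) ∷ ps) {w} {n = n} e sh =
  trans (ren-⊗ ρ (tr s w X n) _)
        (cong₂ _⊗_ (ren-tr ρ s X e (Shifts-take (bullets X) sh))
                   (ren-layout ρ ps e (Shifts-drop (bullets X) sh)))

swapBlocks : ℕ → ℕ → ℕ → Label → Label
swapBlocks a p q l with l <? a | l <? a + p | l <? a + p + q
... | yes _ | _     | _     = l
... | no _  | yes _ | _     = l + q
... | no _  | no _  | yes _ = l ∸ p
... | no _  | no _  | no _  = l

module _ (a p q : ℕ) where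

  swapBlocks-below : ∀ {l} → l < a → swapBlocks a p q l ≡ l
  swapBlocks-below {l} l<a with l <? a
  ... | yes _ = refl
  ... | no l≮a = contradiction l<a l≮a

  swapBlocks-above : ∀ {l} → a + p + q ≤ l → swapBlocks a p q l ≡ l
  swapBlocks-above {l} a+p+q≤l with l <? a | l <? a + p | l <? a + p + q
  ... | yes _ | _           | _             = refl
  ... | no _  | yes l<a+p   | _             =
    contradiction (<-≤-trans l<a+p (≤-trans (m≤m+n (a + p) q) a+p+q≤l)) (n≮n l)
  ... | no _  | no _        | yes l<a+p+q   = contradiction a+p+q≤l (<⇒≱ l<a+p+q)
  ... | no _  | no _        | no _          = refl

  swapBlocks-first : Shifts (swapBlocks a p q) a (a + q) p
  swapBlocks-first = shifts-by λ j j<p → go j j<p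
    where
    go : ∀ j → j < p → swapBlocks a p q (a + j) ≡ a + q + j
    go j j<p with a + j <? a | a + j <? a + p
    ... | yes a+j<a | _        = contradiction a+j<a (m+n≮m a j)
    ... | no _      | yes _    = xy∙z≈xz∙y a j q
    ... | no _      | no a+j≮a+p = contradiction (+-monoʳ-< a j<p) a+j≮a+p

  swapBlocks-second : Shifts (swapBlocks a p q) (a + p) a q
  swapBlocks-second = shifts-by λ j j<q → go j j<q
    where
    go : ∀ j → j < q → swapBlocks a p q (a + p + j) ≡ a + j
    go j j<q with a + p + j <? a | a + p + j <? a + p | a + p + j <? a + p + q
    ... | yes lt | _  | _ =
      contradiction (≤-<-trans (≤-trans (m≤m+n a p) (m≤m+n (a + p) j)) lt) (n≮n a)
    ... | no _ | yes lt | _ = contradiction lt (m+n≮m (a + p) j)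
    ... | no _ | no _ | yes _ = trans (cong (_∸ p) (xy∙z≈xz∙y a p j)) (m+n∸n≡m (a + j) p)
    ... | no _ | no _ | no lt = contradiction (+-monoʳ-< (a + p) j<q) lt

data Split (a : ℕ) : ℕ → Set where
  below : ∀ {l} → l < a → Split a l
  from  : ∀ j → Split a (a + j)

split : ∀ a l → Split a l
split zero l = from l
split (suc a) zero = below z<s
split (suc a) (suc l) with split a l
... | below l<a = below (s<s l<a)
... | from j = from j

swapBlocks-inverse : ∀ a p q l → swapBlocks a q p (swapBlocks a p q l) ≡ l
swapBlocks-inverse a p q l with split a l
... | below l<a =
  trans (cong (swapBlocks a q p) (swapBlocks-below a p q l<a)) (swapBlocks-below a q p l<a)
... | from j with split p j
...   | below j<p =
  trans (cong (swapBlocks a q p) (shift (swapBlocks-first a p q) j j<p))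
        (shift (swapBlocks-second a q p) j j<p)
...   | from k with split q k
...     | below k<q = begin
  swapBlocks a q p (swapBlocks a p q (a + (p + k)))
    ≡⟨ cong (λ l → swapBlocks a q p (swapBlocks a p q l)) (sym (+-assoc a p k)) ⟩
  swapBlocks a q p (swapBlocks a p q (a + p + k))
    ≡⟨ cong (swapBlocks a q p) (shift (swapBlocks-second a p q) k k<q) ⟩
  swapBlocks a q p (a + k)
    ≡⟨ shift (swapBlocks-first a q p) k k<q ⟩
  a + p + k
    ≡⟨ +-assoc a p k ⟩
  a + (p + k) ∎
  where open ≡-Reasoning
...     | from m =
  trans (cong (swapBlocks a q p) (swapBlocks-above a p q (begin
      a + p + q       ≡⟨ +-assoc a p q ⟩
      a + (p + q)     ≤⟨ inner ⟩
      a + (p + (q + m)) ∎)))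
    (swapBlocks-above a q p (begin
      a + q + p       ≡⟨ xy∙z≈xz∙y a q p ⟩
      a + p + q       ≡⟨ +-assoc a p q ⟩
      a + (p + q)     ≤⟨ inner ⟩
      a + (p + (q + m)) ∎))
  where
  open ≤-Reasoning
  inner : a + (p + q) ≤ a + (p + (q + m))
  inner = +-monoʳ-≤ a (+-monoʳ-≤ p (m≤m+n q m))

layout-swap : ∀ {w n} → w < n → ∀ ps qs rs ts →
  layout w n (ps ++ qs ++ rs ++ ts) ≅ layout w n (ps ++ rs ++ qs ++ ts)
layout-swap {w} {n} w<n ps qs rs ts =
  ≅-trans (ren-≅ ρ (swapBlocks a r q) (swapBlocks-inverse a q r) _)
          (~⇒≅ (subst₂ _~_ (sym renamed) (sym swapped)
            (⊗-shifts (layout w n ps) (layout w (a + r) qs) (layout w a rs) (layout w (a + r + q) ts))))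
  where
  a = n + width ps
  q = width qs
  r = width rs
  ρ = swapBlocks a q r
  ρ-fixes-w : ρ w ≡ w
  ρ-fixes-w = swapBlocks-below a q r (<-≤-trans w<n (m≤m+n n (width ps)))
  renamed : ren ρ (layout w n (ps ++ qs ++ rs ++ ts)) ≡
            layout w n ps ⊗ (layout w (a + r) qs ⊗ (layout w a rs ⊗ layout w (a + r + q) ts))
  renamed = begin
    ren ρ (layout w n (ps ++ qs ++ rs ++ ts))
      ≡⟨ cong (ren ρ) (layout-++₄ w n ps qs rs ts) ⟩
    ren ρ (layout w n ps ⊗ (layout w a qs ⊗ (layout w (a + q) rs ⊗ layout w (a + q + r) ts)))
      ≡⟨ ren-⊗₄ ρ (layout w n ps) (layout w a qs) (layout w (a + q) rs) (layout w (a + q + r) ts) ⟩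
    ren ρ (layout w n ps) ⊗ (ren ρ (layout w a qs) ⊗
      (ren ρ (layout w (a + q) rs) ⊗ ren ρ (layout w (a + q + r) ts)))
      ≡⟨ cong₂ _⊗_ (ren-layout ρ ps ρ-fixes-w prefix-fixed)
           (cong₂ _⊗_ (ren-layout ρ qs ρ-fixes-w (swapBlocks-first a q r))
             (cong₂ _⊗_ (ren-layout ρ rs ρ-fixes-w (swapBlocks-second a q r))
                        (ren-layout ρ ts ρ-fixes-w suffix-shifted))) ⟩
    layout w n ps ⊗ (layout w (a + r) qs ⊗ (layout w a rs ⊗ layout w (a + r + q) ts)) ∎
    where
    open ≡-Reasoning
    prefix-fixed : Shifts ρ n n (width ps)
    prefix-fixed = shifts-by λ j j<k → swapBlocks-below a q r (+-monoʳ-< n j<k)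
    suffix-shifted : Shifts ρ (a + q + r) (a + r + q) (width ts)
    suffix-shifted = shifts-by λ j _ →
      trans (swapBlocks-above a q r (m≤m+n (a + q + r) j)) (cong (_+ j) (xy∙z≈xz∙y a q r))
  swapped : layout w n (ps ++ rs ++ qs ++ ts) ≡
            layout w n ps ⊗ (layout w a rs ⊗ (layout w (a + r) qs ⊗ layout w (a + r + q) ts))
  swapped = layout-++₄ w n ps rs qs ts

layout-swap-end : ∀ {w n} → w < n → ∀ ps qs rs →
  layout w n (ps ++ qs ++ rs) ≅ layout w n (ps ++ rs ++ qs)
layout-swap-end {w} {n} w<n ps qs rs =
  subst₂ (λ rs' qs' → layout w n (ps ++ qs ++ rs') ≅ layout w n (ps ++ rs ++ qs'))
         (++-identityʳ rs) (++-identityʳ qs) (layout-swap w<n ps qs rs [])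

𝔏-•-display : ∀ w X Y → 𝔏 w (X ⊢ • Y) ≅ 𝔏 w (• X ⊢ Y)
𝔏-•-display w X Y =
  subst₂ _≅_ (sym (𝔏-closed w X (• Y))) (sym (𝔏-closed w (• X) Y))
    (≅-trans (ren-≅ ρ (swapBlocks w 1 (suc x)) (swapBlocks-inverse w (suc x) 1) _)
             (~⇒≅ (subst₂ _~_ (sym renamed) (sym regrouped) (⊗-shifts emptyS TX E TY))))
  -- emptyS ⊗ S is definitionally S, by η for LSeq.
  where
  x = bullets X
  s = suc w
  ρ = swapBlocks w (suc x) 1
  E = edge lhs w s
  TX = tr lhs s X (suc s)
  TY = tr rhs w Y (suc (s + x))
  w-X-block : Shifts ρ w s (suc x)
  w-X-block = subst (λ m → Shifts ρ w m (suc x)) (+-comm w 1) (swapBlocks-first w (suc x) 1)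
  ρ-last : ρ (s + x) ≡ w
  ρ-last = trans (cong ρ (sym (+-suc w x))) (Shifts-head (swapBlocks-second w (suc x) 1))
  Y-fixed : Shifts ρ (suc (s + x)) (suc (s + x)) (bullets Y)
  Y-fixed = shifts-by λ j _ → swapBlocks-above w (suc x) 1 (≤-trans (≤-reflexive end) (m≤m+n _ j))
    where
    end : w + suc x + 1 ≡ suc (s + x)
    end = trans (+-comm (w + suc x) 1) (cong suc (+-suc w x))
  renamed : ren ρ (tr lhs w X s ⊗ tr rhs w (• Y) (s + x)) ≡ TX ⊗ (E ⊗ TY)
  renamed = begin
    ren ρ (tr lhs w X s ⊗ (edge rhs w (s + x) ⊗ tr rhs (s + x) Y (suc (s + x))))
      ≡⟨ trans (ren-⊗ ρ (tr lhs w X s) _)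
               (cong (ren ρ (tr lhs w X s) ⊗_) (ren-⊗ ρ (edge rhs w (s + x)) _)) ⟩
    ren ρ (tr lhs w X s) ⊗ (edge rhs (ρ w) (ρ (s + x)) ⊗ ren ρ (tr rhs (s + x) Y (suc (s + x))))
      ≡⟨ cong₂ _⊗_ (ren-tr ρ lhs X (Shifts-head w-X-block) (Shifts-tail w-X-block))
           (cong₂ _⊗_ (cong₂ (edge rhs) (Shifts-head w-X-block) ρ-last)
                      (ren-tr ρ rhs Y ρ-last Y-fixed)) ⟩
    TX ⊗ (E ⊗ TY) ∎
    where open ≡-Reasoning
  regrouped : tr lhs w (• X) s ⊗ tr rhs w Y (s + suc x) ≡ E ⊗ (TX ⊗ TY)
  regrouped = trans (cong (λ m → (E ⊗ TX) ⊗ tr rhs w Y m) (+-suc s x)) (⊗-assoc E TX TY)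

layout-≅-resp-≡ : ∀ {w n ps qs ps' qs'} → ps ≡ qs → ps' ≡ qs' →
                  layout w n qs ≅ layout w n qs' → layout w n ps ≅ layout w n ps'
layout-≅-resp-≡ refl refl i = i

LayoutIso : Label → DSeq → DSeq → Set
LayoutIso w D D' = layout w (suc w) (seqPieces D) ≅ layout w (suc w) (seqPieces D')

Bi-LayoutIso : ∀ w {D D'} → Bi D D' → LayoutIso w D D'
Bi-LayoutIso w (d1 X Y Z) =
  layout-≅-resp-≡ (++-assoc (pieces lhs X) (pieces lhs Y) (pieces rhs Z)) refl
    (layout-swap-end (n<1+n w) (pieces lhs X) (pieces lhs Y) (pieces rhs Z))
Bi-LayoutIso w (d2 X Y Z) =
  layout-≅-resp-≡ (++-assoc (pieces lhs X) (pieces lhs Y) (pieces rhs Z)) refl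
    (layout-swap (n<1+n w) [] (pieces lhs X) (pieces lhs Y) (pieces rhs Z))
Bi-LayoutIso w (d3 X Y Z) =
  layout-≅-resp-≡ refl (++-assoc (pieces lhs X) (pieces rhs Z) (pieces rhs Y))
    (layout-swap-end (n<1+n w) (pieces lhs X) (pieces rhs Y) (pieces rhs Z))
Bi-LayoutIso w (d4 X Y Z) =
  layout-≅-resp-≡ refl (++-assoc (pieces rhs Y) (pieces lhs X) (pieces rhs Z))
    (layout-swap (n<1+n w) [] (pieces lhs X) (pieces rhs Y) (pieces rhs Z))
Bi-LayoutIso w (d5 X Y) = layout-swap-end (n<1+n w) [] (pieces rhs X) (pieces rhs Y)
Bi-LayoutIso w (d6 X Y) = layout-swap-end (n<1+n w) [] (pieces lhs X) (pieces lhs Y)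
Bi-LayoutIso w (d7 X Y) = ≅-refl
Bi-LayoutIso w (d8 X Y) = ≅-refl
Bi-LayoutIso w (d9 X Y) =
  subst₂ _≅_ (𝔏-layout w (X ⊢ • Y)) (𝔏-layout w (• X ⊢ Y)) (𝔏-•-display w X Y)
Bi-LayoutIso w (Il X Y) = ≅-refl
Bi-LayoutIso w (Ir X Y) = ≅-refl
Bi-LayoutIso w (ql Y) = ≅-refl
Bi-LayoutIso w (qr X) = ≅-refl
Bi-LayoutIso w (al X Y Z W) =
  layout-≅-resp-≡ (cong (_++ pieces rhs W) (sym (++-assoc (pieces lhs X) (pieces lhs Y) (pieces lhs Z))))
    refl ≅-refl
Bi-LayoutIso w (ar X Y Z W) =
  layout-≅-resp-≡ (cong (pieces lhs X ++_) (sym (++-assoc (pieces rhs Y) (pieces rhs Z) (pieces rhs W))))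
    refl ≅-refl

Step-LayoutIso : ∀ w {D' D} → Step D' D → LayoutIso w D D'
Step-LayoutIso w (fwd b) = ≅-sym (Bi-LayoutIso w b)
Step-LayoutIso w (bwd b) = Bi-LayoutIso w b
Step-LayoutIso w (pl X Y Z) =
  layout-≅-resp-≡ (++-assoc (pieces lhs Y) (pieces lhs X) (pieces rhs Z))
    (++-assoc (pieces lhs X) (pieces lhs Y) (pieces rhs Z))
    (layout-swap (n<1+n w) [] (pieces lhs Y) (pieces lhs X) (pieces rhs Z))
Step-LayoutIso w (pr X Y Z) = layout-swap-end (n<1+n w) (pieces lhs X) (pieces rhs Z) (pieces rhs Y)

lemma4 : ∀ (w : Label) (D' D : DSeq) → Step D' D → 𝔏 w D ≅ 𝔏 w D'
lemma4 w D' D step = subst₂ _≅_ (sym (𝔏-layout w D)) (sym (𝔏-layout w D')) (Step-LayoutIso w step)
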